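{- Consider the Game of Cards with $p$ players and $n$ cards. Let $O$ be a configuration, and let $\mathcal C$ be a sequence of moves from $O$ to a configuration $a$ and $\mathcal D$ a sequence of moves from $O$ to a configuration $b$. Assume there is an index $j\in\{1,\dots,p\}$ such that $s_j(\mathcal C)\le s_j(\mathcal D)$ and $s_{j'}(\mathcal C)\ge s_{j'}(\mathcal D)$ for all $j'\neq j$. If a move at position $j$ is allowed in $b$, then a move at position $j$ is also allowed in $a$.
   Context: Game of Cards: $p$ players sit in a cycle; indices are taken modulo $p$ (player $p$'s right neighbor is player $1$). A configuration is a vector $a=(a_1,\dots,a_p)$ of nonnegative integers with $\sum_i a_i=n$. A move at position $i$ is allowed in $a$ iff $a_i>a_{i+1}$ (with $a_{p+1}=a_1$); it replaces $a_i$ by $a_i-1$ and $a_{i+1}$ by $a_{i+1}+1$ (player $i$ gives a card to player $i+1$). For a finite sequence of moves $\mathcal C$, its shot vector is $s(\mathcal C)=(s_1(\mathcal C),\dots,s_p(\mathcal C))$, where $s_i(\mathcal C)$ is the number of moves at position $i$ in $\mathcal C$. -}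

module Defs where

open import Data.Nat using (ℕ; zero; suc; _+_; _∸_; _<_; _≤_; _<?_)
open import Data.Fin using (Fin; toℕ; fromℕ<)
open import Data.Fin.Properties using (_≟_)
open import Data.List using (List; []; _∷_; map; allFin)
open import Data.Nat.ListAction using (sum)
open import Relation.Nullary using (yes; no)

-- Configurations of p players: a i for i : Fin p (paper's player i+1 is index i).
Config : ℕ → Set
Config p = Fin p → ℕ

total : ∀ {p} → Config p → ℕ
total {p} a = sum (map a (allFin p))

next : ∀ {p} → Fin p → Fin p
next {suc k} i with suc (toℕ i) <? suc k
... | yes lt = fromℕ< lt
... | no _  = Fin.zero

Allowed : ∀ {p} → Config p → Fin p → Set
Allowed a i = a (next i) < a i

-- effect of a move at position i: a_i - 1, a_{i+1} + 1
-- (well-defined since i ≠ next i whenever the move is allowed)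
move : ∀ {p} → Config p → Fin p → Config p
move a i k with k ≟ i | k ≟ next i
... | yes _ | _     = a k ∸ 1
... | no _  | yes _ = a k + 1
... | no _  | no _  = a k

data Moves {p : ℕ} : Config p → List (Fin p) → Config p → Set where
  done : ∀ {a} → Moves a [] a
  step : ∀ {a b i ms} → Allowed a i → Moves (move a i) ms b → Moves a (i ∷ ms) b

shots : ∀ {p} → List (Fin p) → Fin p → ℕ
shots [] j = 0
shots (i ∷ ms) j with i ≟ j
... | yes _ = suc (shots ms j)
... | no _  = shots ms j

-- Counting cards, player k's hand changes only through the s_k cards it gives away and the
-- s_{k-1} cards it receives, so a_k + s_k = O_k + s_{k-1}.  Applying this at j and j+1 gives
-- a_j - a_{j+1} = (O_j - O_{j+1}) + s_{j-1} + s_{j+1} - 2 s_j, which is monotone in the shot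
-- vector: it can only grow when passing from D to C, since s_j decreases while all other
-- entries increase.  Hence b_j > b_{j+1} forces a_j > a_{j+1}.
module Submission where

open import Defs
open import Data.Nat using (ℕ; suc; _≤_; _<_; _+_; _∸_; _<?_; s≤s; s≤s⁻¹)
open import Data.Nat.Properties
  using (+-suc; +-assoc; +-mono-≤; +-monoʳ-≤; +-cancelʳ-≤; ≤-antisym; ≮⇒≥;
         <-irrefl; m<n⇒0<n; m+[n∸m]≡n; +-commutativeSemigroup; module ≤-Reasoning)
open import Algebra.Properties.CommutativeSemigroup +-commutativeSemigroup using (x∙yz≈y∙xz)
open import Data.Nat.Solver using (module +-*-Solver)
open import Data.Fin using (Fin; toℕ; fromℕ; inject₁)
open import Data.Fin.Properties using (_≟_; toℕ-injective; toℕ-fromℕ<; toℕ-fromℕ; toℕ-inject₁; toℕ<n)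
open import Data.List using (List; _∷_)
open import Data.Empty using (⊥-elim)
open import Function using (_∘_)
open import Relation.Binary.PropositionalEquality
open import Relation.Nullary using (¬_; yes; no)

prev : ∀ {p} → Fin p → Fin p
prev {suc m} Fin.zero    = fromℕ m
prev {suc m} (Fin.suc k) = inject₁ k

prev-next : ∀ {p} (i : Fin p) → prev (next i) ≡ i
prev-next {suc m} i with suc (toℕ i) <? suc m
... | yes lt = toℕ-injective (trans (toℕ-inject₁ _) (toℕ-fromℕ< (s≤s⁻¹ lt)))
... | no ¬lt = toℕ-injective (trans (toℕ-fromℕ m) (≤-antisym (s≤s⁻¹ (≮⇒≥ ¬lt)) (s≤s⁻¹ (toℕ<n i))))

next-prev : ∀ {p} (k : Fin p) → next (prev k) ≡ k
next-prev {suc m} Fin.zero with suc (toℕ (fromℕ m)) <? suc m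
... | yes lt = ⊥-elim (<-irrefl (cong suc (toℕ-fromℕ m)) lt)
... | no _   = refl
next-prev {suc m} (Fin.suc k) with suc (toℕ (inject₁ k)) <? suc m
... | yes lt = toℕ-injective (trans (toℕ-fromℕ< lt) (cong suc (toℕ-inject₁ k)))
... | no ¬lt = ⊥-elim (¬lt (s≤s (subst (_< m) (sym (toℕ-inject₁ k)) (toℕ<n k))))

allowed⇒next≢ : ∀ {p} (a : Config p) i → Allowed a i → ¬ next i ≡ i
allowed⇒next≢ a i allowed eq = <-irrefl (cong a eq) allowed

shots-self : ∀ {p} (i : Fin p) ms → shots (i ∷ ms) i ≡ suc (shots ms i)
shots-self i ms with i ≟ i
... | yes _  = refl
... | no i≢i = ⊥-elim (i≢i refl)

shots-other : ∀ {p} {i j : Fin p} ms → ¬ i ≡ j → shots (i ∷ ms) j ≡ shots ms j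
shots-other {i = i} {j} ms i≢j with i ≟ j
... | yes i≡j = ⊥-elim (i≢j i≡j)
... | no _    = refl

balance : ∀ {p} {O a : Config p} {C} → Moves O C a → ∀ k → a k + shots C k ≡ O k + shots C (prev k)
balance done k = refl
balance {O = O} {a} (step {i = i} {ms = ms} allowed moves) k with k ≟ i | k ≟ next i | balance moves k
... | yes refl | _ | ih = begin
  a k + shots (k ∷ ms) k             ≡⟨ cong (a k +_) (shots-self k ms) ⟩
  a k + suc (shots ms k)             ≡⟨ +-suc (a k) _ ⟩
  suc (a k + shots ms k)             ≡⟨ cong suc ih ⟩
  1 + (O k ∸ 1) + shots ms (prev k)  ≡⟨ cong (_+ shots ms (prev k)) (m+[n∸m]≡n (m<n⇒0<n allowed)) ⟩
  O k + shots ms (prev k)            ≡⟨ cong (O k +_) (shots-other ms k≢prev) ⟨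
  O k + shots (k ∷ ms) (prev k)      ∎
  where
    open ≡-Reasoning
    k≢prev : ¬ k ≡ prev k
    k≢prev eq = allowed⇒next≢ O k allowed (trans (cong next eq) (next-prev k))
... | no k≢i | yes refl | ih = begin
  a k + shots (i ∷ ms) k             ≡⟨ cong (a k +_) (shots-other ms (k≢i ∘ sym)) ⟩
  a k + shots ms k                   ≡⟨ ih ⟩
  O k + 1 + shots ms (prev k)        ≡⟨ +-assoc (O k) 1 _ ⟩
  O k + suc (shots ms (prev k))      ≡⟨ cong (λ l → O k + suc (shots ms l)) (prev-next i) ⟩
  O k + suc (shots ms i)             ≡⟨ cong (O k +_) (shots-self i ms) ⟨
  O k + shots (i ∷ ms) i             ≡⟨ cong (λ l → O k + shots (i ∷ ms) l) (prev-next i) ⟨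
  O k + shots (i ∷ ms) (prev k)      ∎
  where open ≡-Reasoning
... | no k≢i | no k≢next | ih = begin
  a k + shots (i ∷ ms) k             ≡⟨ cong (a k +_) (shots-other ms (k≢i ∘ sym)) ⟩
  a k + shots ms k                   ≡⟨ ih ⟩
  O k + shots ms (prev k)            ≡⟨ cong (O k +_) (shots-other ms i≢prev) ⟨
  O k + shots (i ∷ ms) (prev k)      ∎
  where
    open ≡-Reasoning
    i≢prev : ¬ i ≡ prev k
    i≢prev eq = k≢next (trans (sym (next-prev k)) (cong next (sym eq)))

drop-identity : ∀ {aj an Oj On x u w : ℕ} → aj + x ≡ Oj + u → an + w ≡ On + x →
                aj + (On + (x + x)) ≡ an + (Oj + (u + w))
drop-identity {aj} {an} {Oj} {On} {x} {u} {w} eⱼ eₙ = begin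
  aj + (On + (x + x))    ≡⟨ solve 3 (λ aj On x → aj :+ (On :+ (x :+ x)) := (aj :+ x) :+ (On :+ x)) refl aj On x ⟩
  (aj + x) + (On + x)    ≡⟨ cong₂ _+_ eⱼ (sym eₙ) ⟩
  (Oj + u) + (an + w)    ≡⟨ solve 4 (λ Oj u an w → (Oj :+ u) :+ (an :+ w) := an :+ (Oj :+ (u :+ w))) refl Oj u an w ⟩
  an + (Oj + (u + w))    ∎
  where
    open ≡-Reasoning
    open +-*-Solver

drop-mono : ∀ {aj an bj bn P Q P′ Q′ : ℕ} → aj + P ≡ an + Q → bj + P′ ≡ bn + Q′ →
            P ≤ P′ → Q′ ≤ Q → bn < bj → an < aj
drop-mono {aj} {an} {bj} {bn} {P} {Q} {P′} {Q′} eₐ e_b P≤P′ Q′≤Q bn<bj =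
  +-cancelʳ-≤ (bj + P′) (suc an) aj (begin
    suc an + (bj + P′)   ≡⟨ cong (suc an +_) e_b ⟩
    suc an + (bn + Q′)   ≡⟨ x∙yz≈y∙xz (suc an) bn Q′ ⟩
    bn + (suc an + Q′)   ≡⟨ +-suc bn (an + Q′) ⟩
    suc bn + (an + Q′)   ≤⟨ +-mono-≤ bn<bj (+-monoʳ-≤ an Q′≤Q) ⟩
    bj + (an + Q)        ≡⟨ cong (bj +_) eₐ ⟨
    bj + (aj + P)        ≤⟨ +-monoʳ-≤ bj (+-monoʳ-≤ aj P≤P′) ⟩
    bj + (aj + P′)       ≡⟨ x∙yz≈y∙xz bj aj P′ ⟩
    aj + (bj + P′)       ∎)
  where open ≤-Reasoning

-- The header's formula for a_j - a_{j+1}, with both sides moved so that no subtraction occurs.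
drop-balance : ∀ {p} {O a : Config p} {C} → Moves O C a → ∀ j →
               a j + (O (next j) + (shots C j + shots C j))
                 ≡ a (next j) + (O j + (shots C (prev j) + shots C (next j)))
drop-balance {O = O} {a} {C} moves j =
  drop-identity {a j} {a (next j)} {O j} {O (next j)} {shots C j} (balance moves j)
                (subst (λ k → a (next j) + shots C (next j) ≡ O (next j) + shots C k)
                       (prev-next j) (balance moves (next j)))

lemma1 : (p n : ℕ) (O a b : Config p) (C D : List (Fin p)) →
         total O ≡ n →
         Moves O C a → Moves O D b →
         (j : Fin p) →
         shots C j ≤ shots D j →
         ((j′ : Fin p) → ¬ (j′ ≡ j) → shots D j′ ≤ shots C j′) →
         Allowed b j → Allowed a j
lemma1 p n O a b C D _ movesC movesD j Cⱼ≤Dⱼ D≤C allowed =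
  drop-mono (drop-balance movesC j) (drop-balance movesD j)
            (+-monoʳ-≤ (O (next j)) (+-mono-≤ Cⱼ≤Dⱼ Cⱼ≤Dⱼ))
            (+-monoʳ-≤ (O j) (+-mono-≤ (D≤C (prev j) prev≢j) (D≤C (next j) next≢j)))
            allowed
  where
    next≢j : ¬ next j ≡ j
    next≢j = allowed⇒next≢ b j allowed
    prev≢j : ¬ prev j ≡ j
    prev≢j eq = next≢j (trans (cong next (sym eq)) (next-prev j))
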